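{- Every shellable simplicial complex is sesquiconstructible.
   Context: A simplex is the complex of all subsets of a finite set. A pure complex has all facets (maximal faces) of the same dimension; ridges are faces of dimension one less than the facets. For a pure complex $\Gamma$, $\partial\Gamma$ is the subcomplex of all faces contained in some ridge lying in exactly one facet of $\Gamma$ ($\partial\Gamma=\emptyset$ if there is no such ridge). A pure complex $\Gamma$ of dimension $n-1$ is shellable if either $\Gamma$ is a simplex, or $\Gamma = U \cup V$ where $U$ is a shellable complex of dimension $n-1$, $V$ is a simplex of dimension $n-1$, and $U\cap V$ is a shellable complex of dimension $n-2$. A pure complex $\Gamma$ of dimension $n-1$ is sesquiconstructible if either $\Gamma$ is a simplex, or $\Gamma = U \cup V$ where (1) $U$ and $V$ are sesquiconstructible complexes of dimension $n-1$, (2) $U\cap V$ is a sesquiconstructible complex of dimension $n-2$, and (3) either $\partial(U \cap V)=\emptyset$ or $\partial(U\cap V)$ is a sesquiconstructible complex of dimension $n-3$. -}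

module Defs where

open import Data.Nat using (ℕ; zero; suc)
open import Data.Fin.Subset using (Subset; _⊆_; ∣_∣)
open import Data.Fin.Subset.Properties using (⊆-trans)
open import Data.Product using (Σ; ∃; _×_; _,_; proj₁; proj₂)
open import Data.Sum using (_⊎_; inj₁; inj₂)
open import Data.Empty using (⊥)
open import Relation.Nullary using (¬_)
open import Relation.Binary.PropositionalEquality using (_≡_)
open import Function.Bundles using (_⇔_)

record Complex (v : ℕ) : Set₁ where
  field
    face : Subset v → Set
    down : ∀ {σ τ} → σ ⊆ τ → face τ → face σ
open Complex public

module _ {v : ℕ} where

  _≈_ : Complex v → Complex v → Set
  Γ ≈ Δ = ∀ σ → face Γ σ ⇔ face Δ σ

  _∪_ : Complex v → Complex v → Complex v
  face (U ∪ V) σ = face U σ ⊎ face V σ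
  down (U ∪ V) p (inj₁ x) = inj₁ (down U p x)
  down (U ∪ V) p (inj₂ x) = inj₂ (down V p x)

  _∩_ : Complex v → Complex v → Complex v
  face (U ∩ V) σ = face U σ × face V σ
  down (U ∩ V) p (x , y) = down U p x , down V p y

  IsEmpty : Complex v → Set
  IsEmpty Γ = ∀ σ → ¬ face Γ σ

  Facet : Complex v → Subset v → Set
  Facet Γ F = face Γ F × (∀ G → face Γ G → F ⊆ G → G ≡ F)

  -- Rank k = dimension + 1 (number of vertices of the facets).
  -- Γ is pure of dimension k-1: nonempty and every facet has k vertices.
  Pure : ℕ → Complex v → Set
  Pure k Γ = (∃ λ σ → face Γ σ) × (∀ F → Facet Γ F → ∣ F ∣ ≡ k)

  IsSimplex : ℕ → Complex v → Set
  IsSimplex k Γ = Σ (Subset v) λ A → (∣ A ∣ ≡ k) × (∀ σ → face Γ σ ⇔ (σ ⊆ A))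

  RidgeSize : ℕ → Subset v → Set
  RidgeSize zero ρ = ⊥
  RidgeSize (suc k) ρ = ∣ ρ ∣ ≡ k

  InExactlyOneFacet : Complex v → Subset v → Set
  InExactlyOneFacet Γ ρ =
    Σ (Subset v) λ F → Facet Γ F × ρ ⊆ F × (∀ G → Facet Γ G → ρ ⊆ G → G ≡ F)

  ∂ : ℕ → Complex v → Complex v
  face (∂ k Γ) σ = Σ (Subset v) λ ρ →
    σ ⊆ ρ × face Γ ρ × RidgeSize k ρ × InExactlyOneFacet Γ ρ
  down (∂ k Γ) p (ρ , q , r) = ρ , ⊆-trans p q , r

  data Shellable : ℕ → Complex v → Set₁ where
    simplex : ∀ {k Γ} → Pure k Γ → IsSimplex k Γ → Shellable k Γ
    union   : ∀ {k Γ U V} → Pure (suc k) Γ →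
              Shellable (suc k) U → IsSimplex (suc k) V →
              Shellable k (U ∩ V) →
              Γ ≈ (U ∪ V) → Shellable (suc k) Γ

  data Sesquiconstructible : ℕ → Complex v → Set₁ where
    simplex : ∀ {k Γ} → Pure k Γ → IsSimplex k Γ → Sesquiconstructible k Γ
    union   : ∀ {k Γ U V} → Pure (suc k) Γ →
              Sesquiconstructible (suc k) U → Sesquiconstructible (suc k) V →
              Sesquiconstructible k (U ∩ V) →
              (IsEmpty (∂ k (U ∩ V)) ⊎
                Σ ℕ (λ j → (k ≡ suc j) × Sesquiconstructible j (∂ k (U ∩ V)))) →
              Γ ≈ (U ∪ V) → Sesquiconstructible (suc k) Γ

-- A shelling Γ = U ∪ V glues the simplex V = ⟨A⟩ along X = U ∩ V, a pure
-- codimension-one subcomplex of ∂V, i.e. the union of the facets A - a of ⟨A⟩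
-- for a in some set S ⊆ A. A ridge A - a - b of X lies in exactly one facet
-- iff exactly one of a, b is in S, so ∂X consists of the faces of A missing
-- a vertex of S and a vertex of T = A ∖ S. This complex is again shellable
-- (add the facets A - b - c one at a time), so by induction on the dimension
-- ∂X is sesquiconstructible, and the shelling is a sesquiconstruction.
module Submission where

open import Defs
open import Data.Empty using (⊥-elim)
open import Data.Fin using (Fin; zero; suc; _≟_)
open import Data.Fin.Properties using (¬∀⟶∃¬)
open import Data.Fin.Subset using (Subset; _⊆_; _∈_; _∉_; ∣_∣; _─_; _-_; ⁅_⁆; inside; outside)
open import Data.Fin.Subset.Properties
  using (⊆-refl; ⊆-trans; ⊆-antisym; _∈?_; _⊆?_; x∈⁅x⁆; p─⊥≡p; p─q⊆p; x∈p∧x≢y⇒x∈p-y; p⊆q⇒∣p∣≤∣q∣; p⊂q⇒∣p∣<∣q∣)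
open import Data.List using (List; []; _∷_; _++_; filter; allFin)
open import Data.List.Membership.Propositional using (find; lose) renaming (_∈_ to _∈ₗ_; _∉_ to _∉ₗ_)
open import Data.List.Membership.Propositional.Properties using (∈-filter⁺; ∈-filter⁻; ∈-allFin)
open import Data.List.Relation.Binary.Disjoint.Propositional using (Disjoint)
open import Data.List.Relation.Unary.All as All using (All; []; _∷_)
open import Data.List.Relation.Unary.All.Properties using () renaming (++⁺ to All-++⁺)
open import Data.List.Relation.Unary.Any as Any using (Any; here; there)
open import Data.List.Relation.Unary.Any.Properties using (++⁺ˡ; ++⁺ʳ; ++⁻)
open import Data.List.Relation.Unary.AllPairs using ([]; _∷_)
open import Data.List.Relation.Unary.Unique.Propositional using (Unique)
open import Data.List.Relation.Unary.Unique.Propositional.Properties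
  using (filter⁺; allFin⁺; Unique[x∷xs]⇒x∉xs) renaming (++⁺ to Unique-++⁺)
open import Data.Nat using (ℕ; zero; suc; _<_; _≤_)
open import Data.Nat.Induction using (<-rec)
open import Data.Nat.Properties using (suc-injective; <⇒≱; ≤-reflexive; n<1+n; m<n⇒m<1+n)
open import Data.Vec using (_∷_; here; there)
open import Data.Product using (∃; _×_; _,_; proj₁; proj₂)
open import Data.Sum as Sum using (_⊎_; inj₁; inj₂)
open import Function using (_∘_; const)
open import Function.Bundles using (mk⇔; Equivalence)
open import Function.Properties.Equivalence using () renaming (refl to ⇔-refl; sym to ⇔-sym; trans to ⇔-trans)
open import Relation.Binary.PropositionalEquality using (_≡_; _≢_; refl; sym; trans; cong; subst; subst₂)
open import Relation.Nullary using (¬_; Dec; yes; no)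
open import Relation.Nullary.Decidable using (_×-dec_; _⊎-dec_; _→-dec_; ¬?; decidable-stable)
  renaming (map to map-dec)
open Equivalence

private variable
  n m k : ℕ
  p q : Subset n
  x y : Fin n

x∈p─q⇒x∉q : x ∈ p ─ q → x ∉ q
x∈p─q⇒x∉q {x = zero}  {p = _ ∷ _} {q = inside  ∷ _} ()          _
x∈p─q⇒x∉q {x = zero}  {p = _ ∷ _} {q = outside ∷ _} _           ()
x∈p─q⇒x∉q {x = suc _} {p = _ ∷ _} {q = _ ∷ _}       (there x∈) (there x∈q) = x∈p─q⇒x∉q x∈ x∈q

x∉p-x : x ∉ p - x
x∉p-x {x = x} x∈ = x∈p─q⇒x∉q x∈ (x∈⁅x⁆ x)

x∈p⇒suc∣p-x∣≡∣p∣ : x ∈ p → suc ∣ p - x ∣ ≡ ∣ p ∣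
x∈p⇒suc∣p-x∣≡∣p∣ {x = zero}  {p = inside  ∷ p} here        = cong (suc ∘ ∣_∣) (p─⊥≡p p)
x∈p⇒suc∣p-x∣≡∣p∣ {x = suc _} {p = inside  ∷ _} (there x∈p) = cong suc (x∈p⇒suc∣p-x∣≡∣p∣ x∈p)
x∈p⇒suc∣p-x∣≡∣p∣ {x = suc _} {p = outside ∷ _} (there x∈p) = x∈p⇒suc∣p-x∣≡∣p∣ x∈p

x∈p⇒∣p-x∣≡pred : x ∈ p → ∣ p ∣ ≡ suc m → ∣ p - x ∣ ≡ m
x∈p⇒∣p-x∣≡pred x∈p ∣p∣≡ = suc-injective (trans (x∈p⇒suc∣p-x∣≡∣p∣ x∈p) ∣p∣≡)

x∈p⇒∣p∣≢0 : x ∈ p → ∣ p ∣ ≢ 0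
x∈p⇒∣p∣≢0 x∈p ∣p∣≡0 with () ← trans (x∈p⇒suc∣p-x∣≡∣p∣ x∈p) ∣p∣≡0

x∈p∧x≢y∧x≢z⇒x∈p-y-z : ∀ {z} → x ∈ p → x ≢ y → x ≢ z → x ∈ p - y - z
x∈p∧x≢y∧x≢z⇒x∈p-y-z x∈p x≢y = x∈p∧x≢y⇒x∈p-y (x∈p∧x≢y⇒x∈p-y x∈p x≢y)

p⊆q-x⇒p⊆q : p ⊆ q - x → p ⊆ q
p⊆q-x⇒p⊆q {q = q} {x = x} p⊆ = p─q⊆p q ⁅ x ⁆ ∘ p⊆

p⊆q-x⇒x∉p : p ⊆ q - x → x ∉ p
p⊆q-x⇒x∉p p⊆ = x∉p-x ∘ p⊆

p⊆q∧x∉p⇒p⊆q-x : p ⊆ q → x ∉ p → p ⊆ q - x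
p⊆q∧x∉p⇒p⊆q-x p⊆q x∉p y∈p = x∈p∧x≢y⇒x∈p-y (p⊆q y∈p) λ { refl → x∉p y∈p }

p⊆q∧∣p∣<∣q∣⇒∃∈q∖p : p ⊆ q → ∣ p ∣ < ∣ q ∣ → ∃ λ x → x ∈ q × x ∉ p
p⊆q∧∣p∣<∣q∣⇒∃∈q∖p {p = p} {q = q} p⊆q ∣p∣<∣q∣ =
  let x , x∈q⇏x∈p = ¬∀⟶∃¬ _ (λ x → x ∈ q → x ∈ p) (λ x → x ∈? q →-dec x ∈? p) q⊈p
  in x , decidable-stable (x ∈? q) (λ x∉q → x∈q⇏x∈p (⊥-elim ∘ x∉q)) , x∈q⇏x∈p ∘ const
  where
  q⊈p : ¬ (∀ x → x ∈ q → x ∈ p)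
  q⊈p q⊆p = <⇒≱ ∣p∣<∣q∣ (p⊆q⇒∣p∣≤∣q∣ λ {x} → q⊆p x)

p⊆q∧∣q∣≤∣p∣⇒p≡q : p ⊆ q → ∣ q ∣ ≤ ∣ p ∣ → p ≡ q
p⊆q∧∣q∣≤∣p∣⇒p≡q {p = p} {q = q} p⊆q ∣q∣≤∣p∣ = ⊆-antisym p⊆q q⊆p
  where
  q⊆p : q ⊆ p
  q⊆p {x} x∈q with x ∈? p
  ... | yes x∈p = x∈p
  ... | no  x∉p = ⊥-elim (<⇒≱ (p⊂q⇒∣p∣<∣q∣ (p⊆q , x , x∈q , x∉p)) ∣q∣≤∣p∣)

module _ {v : ℕ} where

  private variable
    Γ Δ U V : Complex v
    A B σ : Subset v

  ⟨_⟩ : Subset v → Complex v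
  face ⟨ A ⟩ σ = σ ⊆ A
  down ⟨ A ⟩   = ⊆-trans

  ⟨⟩-isSimplex : ∣ A ∣ ≡ k → IsSimplex k ⟨ A ⟩
  ⟨⟩-isSimplex ∣A∣≡k = _ , ∣A∣≡k , λ _ → ⇔-refl

  isSimplex-resp-≈ : Γ ≈ Δ → IsSimplex k Γ → IsSimplex k Δ
  isSimplex-resp-≈ Γ≈Δ (A , ∣A∣≡k , Γ≈⟨A⟩) = A , ∣A∣≡k , λ σ → ⇔-trans (⇔-sym (Γ≈Δ σ)) (Γ≈⟨A⟩ σ)

  pure-resp-≈ : Γ ≈ Δ → Pure k Γ → Pure k Δ
  pure-resp-≈ Γ≈Δ ((σ , σ∈Γ) , facets) =
    (σ , to (Γ≈Δ σ) σ∈Γ) ,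
    λ F (F∈Δ , maxΔ) → facets F (from (Γ≈Δ F) F∈Δ , λ G G∈Γ → maxΔ G (to (Γ≈Δ G) G∈Γ))

  shellable-resp-≈ : Γ ≈ Δ → Shellable k Γ → Shellable k Δ
  shellable-resp-≈ {Γ = Γ} {Δ = Δ} Γ≈Δ (simplex pure s) =
    simplex (pure-resp-≈ {Γ = Γ} {Δ = Δ} Γ≈Δ pure) (isSimplex-resp-≈ {Γ = Γ} {Δ = Δ} Γ≈Δ s)
  shellable-resp-≈ {Γ = Γ} {Δ = Δ} Γ≈Δ (union pure sU sV sUV Γ≈U∪V) =
    union (pure-resp-≈ {Γ = Γ} {Δ = Δ} Γ≈Δ pure) sU sV sUV λ σ → ⇔-trans (⇔-sym (Γ≈Δ σ)) (Γ≈U∪V σ)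

  isSimplex⇒pure : IsSimplex k Γ → Pure k Γ
  isSimplex⇒pure (A , ∣A∣≡k , Γ≈⟨A⟩) =
    (A , A∈Γ) , λ F (F∈Γ , maxΓ) → trans (cong ∣_∣ (sym (maxΓ A A∈Γ (to (Γ≈⟨A⟩ F) F∈Γ)))) ∣A∣≡k
    where A∈Γ = from (Γ≈⟨A⟩ A) ⊆-refl

  shellable⇒pure : Shellable k Γ → Pure k Γ
  shellable⇒pure (simplex pure _)      = pure
  shellable⇒pure (union pure _ _ _ _) = pure

  pure-∪ : Pure k U → Pure k V → Pure k (U ∪ V)
  pure-∪ {U = U} {V = V} ((σ , σ∈U) , facetsU) (_ , facetsV) = (σ , inj₁ σ∈U) , facets
    where
    facets : ∀ F → Facet (U ∪ V) F → ∣ F ∣ ≡ _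
    facets F (inj₁ F∈U , max) = facetsU F (F∈U , λ G → max G ∘ inj₁)
    facets F (inj₂ F∈V , max) = facetsV F (F∈V , λ G → max G ∘ inj₂)

  shellable-dec : Shellable k Γ → ∀ σ → Dec (face Γ σ)
  shellable-dec (simplex _ (A , _ , Γ≈⟨A⟩)) σ = map-dec (⇔-sym (Γ≈⟨A⟩ σ)) (σ ⊆? A)
  shellable-dec (union _ sU (A , _ , V≈⟨A⟩) _ Γ≈U∪V) σ =
    map-dec (⇔-sym (Γ≈U∪V σ)) (shellable-dec sU σ ⊎-dec map-dec (⇔-sym (V≈⟨A⟩ σ)) (σ ⊆? A))

  InFaceOfSize : ℕ → Complex v → Subset v → Set
  InFaceOfSize k Γ σ = ∃ λ G → σ ⊆ G × face Γ G × ∣ G ∣ ≡ k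

  isSimplex⇒covered : IsSimplex k Γ → ∀ σ → face Γ σ → InFaceOfSize k Γ σ
  isSimplex⇒covered (A , ∣A∣≡k , Γ≈⟨A⟩) σ σ∈Γ = A , to (Γ≈⟨A⟩ σ) σ∈Γ , from (Γ≈⟨A⟩ A) ⊆-refl , ∣A∣≡k

  shellable⇒covered : Shellable k Γ → ∀ σ → face Γ σ → InFaceOfSize k Γ σ
  shellable⇒covered {Γ = Γ} (simplex _ s) = isSimplex⇒covered {Γ = Γ} s
  shellable⇒covered (union {V = V} _ sU sV _ Γ≈U∪V) σ σ∈Γ with to (Γ≈U∪V σ) σ∈Γ
  ... | inj₁ σ∈U = let G , σ⊆G , G∈U , ∣G∣≡k = shellable⇒covered sU σ σ∈U
                   in G , σ⊆G , from (Γ≈U∪V G) (inj₁ G∈U) , ∣G∣≡k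
  ... | inj₂ σ∈V = let G , σ⊆G , G∈V , ∣G∣≡k = isSimplex⇒covered {Γ = V} sV σ σ∈V
                   in G , σ⊆G , from (Γ≈U∪V G) (inj₂ G∈V) , ∣G∣≡k

  ⟨⟩-shellable : ∣ A ∣ ≡ k → Shellable k ⟨ A ⟩
  ⟨⟩-shellable {A = A} ∣A∣≡k = simplex (isSimplex⇒pure {Γ = ⟨ A ⟩} s) s
    where s = ⟨⟩-isSimplex ∣A∣≡k

  shellable-∪⟨_⟩ : ∀ A → Shellable (suc k) U → ∣ A ∣ ≡ suc k → Shellable k (U ∩ ⟨ A ⟩) →
                   Shellable (suc k) (U ∪ ⟨ A ⟩)
  shellable-∪⟨_⟩ {U = U} A sU ∣A∣≡ sU∩A =
    union (pure-∪ {U = U} {V = ⟨ A ⟩} (shellable⇒pure sU) (shellable⇒pure (⟨⟩-shellable ∣A∣≡)))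
      sU (⟨⟩-isSimplex ∣A∣≡) sU∩A (λ _ → ⇔-refl)

  All-∈-remove : ∀ {c L} → All (_∈ A) L → c ∉ₗ L → All (_∈ A - c) L
  All-∈-remove L⊆A c∉L = All.tabulate λ x∈L →
    x∈p∧x≢y⇒x∈p-y (All.lookup L⊆A x∈L) λ { refl → c∉L x∈L }

  Misses : List (Fin v) → Subset v → Set
  Misses L σ = Any (_∉ σ) L

  -- Missing A L is the union of the facets A - a, a ∈ L, of the simplex ⟨A⟩.
  Missing : Subset v → List (Fin v) → Complex v
  face (Missing A L) σ = σ ⊆ A × Misses L σ
  down (Missing A L) σ⊆τ (τ⊆A , misses) = ⊆-trans σ⊆τ τ⊆A , Any.map (λ a∉τ → a∉τ ∘ σ⊆τ) misses

  ⊆-remove⇒Missing : ∀ {A a L} → a ∈ₗ L → σ ⊆ A - a → face (Missing A L) σ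
  ⊆-remove⇒Missing a∈L σ⊆A-a = p⊆q-x⇒p⊆q σ⊆A-a , lose a∈L (p⊆q-x⇒x∉p σ⊆A-a)

  Missing-[_] : ∀ A a → ⟨ A - a ⟩ ≈ Missing A (a ∷ [])
  Missing-[ A ] a σ = mk⇔ (⊆-remove⇒Missing (here refl)) back
    where
    back : face (Missing A (a ∷ [])) σ → σ ⊆ A - a
    back (σ⊆A , here a∉σ) = p⊆q∧x∉p⇒p⊆q-x σ⊆A a∉σ

  Missing-∷ : ∀ A a L → (⟨ A - a ⟩ ∪ Missing A L) ≈ Missing A (a ∷ L)
  Missing-∷ A a L σ = mk⇔ forth back
    where
    forth : face (⟨ A - a ⟩ ∪ Missing A L) σ → face (Missing A (a ∷ L)) σ
    forth (inj₁ σ⊆A-a)           = ⊆-remove⇒Missing (here refl) σ⊆A-a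
    forth (inj₂ (σ⊆A , misses)) = σ⊆A , there misses
    back : face (Missing A (a ∷ L)) σ → face (⟨ A - a ⟩ ∪ Missing A L) σ
    back (σ⊆A , here a∉σ)     = inj₁ (p⊆q∧x∉p⇒p⊆q-x σ⊆A a∉σ)
    back (σ⊆A , there misses) = inj₂ (σ⊆A , misses)

  ∪-Missing-[] : ∀ Γ A → Γ ≈ (Γ ∪ Missing A [])
  ∪-Missing-[] Γ A σ = mk⇔ inj₁ back
    where
    back : face (Γ ∪ Missing A []) σ → face Γ σ
    back (inj₁ σ∈Γ) = σ∈Γ

  ∪-Missing-∷ : ∀ Γ A a L → ((Γ ∪ Missing A L) ∪ ⟨ A - a ⟩) ≈ (Γ ∪ Missing A (a ∷ L))
  ∪-Missing-∷ Γ A a L σ = mk⇔ forth back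
    where
    forth : face ((Γ ∪ Missing A L) ∪ ⟨ A - a ⟩) σ → face (Γ ∪ Missing A (a ∷ L)) σ
    forth (inj₁ (inj₁ σ∈Γ))             = inj₁ σ∈Γ
    forth (inj₁ (inj₂ (σ⊆A , misses))) = inj₂ (σ⊆A , there misses)
    forth (inj₂ σ⊆A-a)                  = inj₂ (⊆-remove⇒Missing (here refl) σ⊆A-a)
    back : face (Γ ∪ Missing A (a ∷ L)) σ → face ((Γ ∪ Missing A L) ∪ ⟨ A - a ⟩) σ
    back (inj₁ σ∈Γ)                  = inj₁ (inj₁ σ∈Γ)
    back (inj₂ (σ⊆A , here a∉σ))     = inj₂ (p⊆q∧x∉p⇒p⊆q-x σ⊆A a∉σ)
    back (inj₂ (σ⊆A , there misses)) = inj₁ (inj₂ (σ⊆A , misses))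

  ∪-Missing-∩-⟨⟩ : ∀ Γ A B T L → B ⊆ A → (Γ ∩ ⟨ B ⟩) ≈ Missing B T →
                   Missing B (T ++ L) ≈ ((Γ ∪ Missing A L) ∩ ⟨ B ⟩)
  ∪-Missing-∩-⟨⟩ Γ A B T L B⊆A Γ∩⟨B⟩≈ σ = mk⇔ forth back
    where
    forth : face (Missing B (T ++ L)) σ → face ((Γ ∪ Missing A L) ∩ ⟨ B ⟩) σ
    forth (σ⊆B , misses) with ++⁻ T misses
    ... | inj₁ missesT = inj₁ (proj₁ (from (Γ∩⟨B⟩≈ σ) (σ⊆B , missesT))) , σ⊆B
    ... | inj₂ missesL = inj₂ (⊆-trans σ⊆B B⊆A , missesL) , σ⊆B
    back : face ((Γ ∪ Missing A L) ∩ ⟨ B ⟩) σ → face (Missing B (T ++ L)) σ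
    back (inj₁ σ∈Γ , σ⊆B)             = σ⊆B , ++⁺ˡ (proj₂ (to (Γ∩⟨B⟩≈ σ) (σ∈Γ , σ⊆B)))
    back (inj₂ (_ , missesL) , σ⊆B) = σ⊆B , ++⁺ʳ T missesL

  ⟨-⟩∩⟨⟩ : ∀ A a B → B ⊆ A → (⟨ A - a ⟩ ∩ ⟨ B ⟩) ≈ Missing B (a ∷ [])
  ⟨-⟩∩⟨⟩ A a B B⊆A σ = mk⇔ forth back
    where
    forth : face (⟨ A - a ⟩ ∩ ⟨ B ⟩) σ → face (Missing B (a ∷ [])) σ
    forth (σ⊆A-a , σ⊆B) = σ⊆B , here (p⊆q-x⇒x∉p σ⊆A-a)
    back : face (Missing B (a ∷ [])) σ → face (⟨ A - a ⟩ ∩ ⟨ B ⟩) σ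
    back (σ⊆B , here a∉σ) = p⊆q∧x∉p⇒p⊆q-x (⊆-trans σ⊆B B⊆A) a∉σ , σ⊆B

  -- Adding the facets B - c, c ∈ L, of ⟨B⟩ to Γ one at a time is a shelling, since each new facet
  -- meets the previous ones in a complex Missing (B - c) (t ∷ T ++ L′) of one dimension less.
  Missing-shellable : ∀ m {A} a L → ∣ A ∣ ≡ suc m → All (_∈ A) (a ∷ L) → Unique (a ∷ L) →
                      Shellable m (Missing A (a ∷ L))
  ∪-Missing-shellable : ∀ m {Γ B} t T L → ∣ B ∣ ≡ suc (suc m) →
                        All (_∈ B) (t ∷ T) → All (_∈ B) L → Unique (t ∷ T) → Unique L → Disjoint (t ∷ T) L →
                        (∀ {c} → c ∈ₗ L → (Γ ∩ ⟨ B - c ⟩) ≈ Missing (B - c) (t ∷ T)) →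
                        Shellable (suc m) Γ → Shellable (suc m) (Γ ∪ Missing B L)

  Missing-shellable m {A} a [] ∣A∣≡ (a∈A ∷ []) _ =
    shellable-resp-≈ (Missing-[ A ] a) (⟨⟩-shellable (x∈p⇒∣p-x∣≡pred a∈A ∣A∣≡))
  Missing-shellable zero a (c ∷ L) ∣A∣≡ (a∈A ∷ c∈A ∷ _) ((a≢c ∷ _) ∷ _) =
    ⊥-elim (x∈p⇒∣p∣≢0 (x∈p∧x≢y⇒x∈p-y c∈A (a≢c ∘ sym)) (x∈p⇒∣p-x∣≡pred a∈A ∣A∣≡))
  Missing-shellable (suc m) {A} a (c ∷ L) ∣A∣≡ (a∈A ∷ cL⊆A) u@(_ ∷ uL) =
    shellable-resp-≈ (Missing-∷ A a (c ∷ L))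
      (∪-Missing-shellable m a [] (c ∷ L) ∣A∣≡ (a∈A ∷ []) cL⊆A ([] ∷ []) uL
        (λ { (here refl , a∈cL) → Unique[x∷xs]⇒x∉xs u a∈cL })
        (λ {c′} _ → ⟨-⟩∩⟨⟩ A a (A - c′) (p─q⊆p A ⁅ c′ ⁆))
        (⟨⟩-shellable (x∈p⇒∣p-x∣≡pred a∈A ∣A∣≡)))

  ∪-Missing-shellable m {Γ} {B} t T [] _ _ _ _ _ _ _ sΓ = shellable-resp-≈ (∪-Missing-[] Γ B) sΓ
  ∪-Missing-shellable m {Γ} {B} t T (c ∷ L) ∣B∣≡ tT⊆B (c∈B ∷ L⊆B) uT uL@(_ ∷ uL′) disjoint
                      Γ∩⟨B-c⟩≈ sΓ =
    shellable-resp-≈ (∪-Missing-∷ Γ B c L)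
      (shellable-∪⟨ B - c ⟩
        (∪-Missing-shellable m t T L ∣B∣≡ tT⊆B L⊆B uT uL′ disjoint′ (Γ∩⟨B-c⟩≈ ∘ there) sΓ)
        ∣B-c∣≡
        (shellable-resp-≈ (∪-Missing-∩-⟨⟩ Γ B (B - c) (t ∷ T) L (p─q⊆p B ⁅ c ⁆) (Γ∩⟨B-c⟩≈ (here refl)))
          (Missing-shellable m t (T ++ L) ∣B-c∣≡
            (All-++⁺ (All-∈-remove tT⊆B λ c∈tT → disjoint (c∈tT , here refl))
                     (All-∈-remove L⊆B (Unique[x∷xs]⇒x∉xs uL)))
            (Unique-++⁺ uT uL′ disjoint′))))
    where
    disjoint′ : Disjoint (t ∷ T) L
    disjoint′ (x∈tT , x∈L) = disjoint (x∈tT , there x∈L)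
    ∣B-c∣≡ : ∣ B - c ∣ ≡ suc m
    ∣B-c∣≡ = x∈p⇒∣p-x∣≡pred c∈B ∣B∣≡

  Missing∩Missing-[_] : ∀ A S t → Missing (A - t) S ≈ (Missing A S ∩ Missing A (t ∷ []))
  Missing∩Missing-[ A ] S t σ = mk⇔ forth back
    where
    forth : face (Missing (A - t) S) σ → face (Missing A S ∩ Missing A (t ∷ [])) σ
    forth (σ⊆A-t , missesS) = (p⊆q-x⇒p⊆q σ⊆A-t , missesS) , ⊆-remove⇒Missing (here refl) σ⊆A-t
    back : face (Missing A S ∩ Missing A (t ∷ [])) σ → face (Missing (A - t) S) σ
    back ((σ⊆A , missesS) , (_ , here t∉σ)) = p⊆q∧x∉p⇒p⊆q-x σ⊆A t∉σ , missesS

  Missing∩Missing-∷ : ∀ A S b T →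
                      ((Missing A S ∩ Missing A T) ∪ Missing (A - b) S) ≈ (Missing A S ∩ Missing A (b ∷ T))
  Missing∩Missing-∷ A S b T σ = mk⇔ forth back
    where
    forth : face ((Missing A S ∩ Missing A T) ∪ Missing (A - b) S) σ →
            face (Missing A S ∩ Missing A (b ∷ T)) σ
    forth (inj₁ (σ∈S , (σ⊆A , missesT))) = σ∈S , (σ⊆A , there missesT)
    forth (inj₂ (σ⊆A-b , missesS))       =
      (p⊆q-x⇒p⊆q σ⊆A-b , missesS) , ⊆-remove⇒Missing (here refl) σ⊆A-b
    back : face (Missing A S ∩ Missing A (b ∷ T)) σ →
           face ((Missing A S ∩ Missing A T) ∪ Missing (A - b) S) σ
    back ((σ⊆A , missesS) , (_ , here b∉σ)) = inj₂ (p⊆q∧x∉p⇒p⊆q-x σ⊆A b∉σ , missesS)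
    back (σ∈S , (σ⊆A , there missesT))      = inj₁ (σ∈S , (σ⊆A , missesT))

  Missing∩Missing-∩-⟨⟩ : ∀ A S T B {c} → B ⊆ A → c ∈ₗ S → c ∉ B →
                         ((Missing A S ∩ Missing A T) ∩ ⟨ B ⟩) ≈ Missing B T
  Missing∩Missing-∩-⟨⟩ A S T B B⊆A c∈S c∉B σ = mk⇔ forth back
    where
    forth : face ((Missing A S ∩ Missing A T) ∩ ⟨ B ⟩) σ → face (Missing B T) σ
    forth ((_ , (_ , missesT)) , σ⊆B) = σ⊆B , missesT
    back : face (Missing B T) σ → face ((Missing A S ∩ Missing A T) ∩ ⟨ B ⟩) σ
    back (σ⊆B , missesT) = ((σ⊆A , lose c∈S (c∉B ∘ σ⊆B)) , (σ⊆A , missesT)) , σ⊆B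
      where σ⊆A = ⊆-trans σ⊆B B⊆A

  Missing∩Missing-shellable : ∀ j {A} s S t T → ∣ A ∣ ≡ suc (suc j) →
                              All (_∈ A) (s ∷ S) → All (_∈ A) (t ∷ T) → Unique (s ∷ S) → Unique (t ∷ T) →
                              Disjoint (s ∷ S) (t ∷ T) → Shellable j (Missing A (s ∷ S) ∩ Missing A (t ∷ T))
  Missing∩Missing-shellable j {A} s S t [] ∣A∣≡ sS⊆A (t∈A ∷ []) uS _ disjoint =
    shellable-resp-≈ (Missing∩Missing-[ A ] (s ∷ S) t)
      (Missing-shellable j s S (x∈p⇒∣p-x∣≡pred t∈A ∣A∣≡)
        (All-∈-remove sS⊆A λ t∈sS → disjoint (t∈sS , here refl)) uS)
  Missing∩Missing-shellable zero s S b (t ∷ T) ∣A∣≡ (s∈A ∷ _) (b∈A ∷ t∈A ∷ _) _ ((b≢t ∷ _) ∷ _)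
                            disjoint =
    ⊥-elim (x∈p⇒∣p∣≢0 (x∈p∧x≢y∧x≢z⇒x∈p-y-z s∈A (λ { refl → disjoint (here refl , here refl) })
                                                (λ { refl → disjoint (here refl , there (here refl)) }))
                        (x∈p⇒∣p-x∣≡pred (x∈p∧x≢y⇒x∈p-y t∈A (b≢t ∘ sym)) (x∈p⇒∣p-x∣≡pred b∈A ∣A∣≡)))
  Missing∩Missing-shellable (suc j) {A} s S b (t ∷ T) ∣A∣≡ sS⊆A (b∈A ∷ tT⊆A) uS u@(_ ∷ uT)
                            disjoint =
    shellable-resp-≈ (Missing∩Missing-∷ A (s ∷ S) b (t ∷ T))
      (∪-Missing-shellable j t T (s ∷ S) (x∈p⇒∣p-x∣≡pred b∈A ∣A∣≡)
        (All-∈-remove tT⊆A (Unique[x∷xs]⇒x∉xs u))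
        (All-∈-remove sS⊆A λ b∈sS → disjoint (b∈sS , here refl))
        uT uS (λ (x∈tT , x∈sS) → disjoint (x∈sS , there x∈tT))
        (λ {c} c∈sS → Missing∩Missing-∩-⟨⟩ A (s ∷ S) (t ∷ T) (A - b - c)
                        (⊆-trans (p─q⊆p (A - b) ⁅ c ⁆) (p─q⊆p A ⁅ b ⁆)) c∈sS x∉p-x)
        (Missing∩Missing-shellable (suc j) s S t T ∣A∣≡ sS⊆A tT⊆A uS uT
          λ (x∈sS , x∈tT) → disjoint (x∈sS , there x∈tT)))

  Missing∩Missing-empty-or-shellable : ∀ j {A} S T → ∣ A ∣ ≡ suc (suc j) →
    All (_∈ A) S → All (_∈ A) T → Unique S → Unique T → Disjoint S T →
    IsEmpty (Missing A S ∩ Missing A T) ⊎ Shellable j (Missing A S ∩ Missing A T)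
  Missing∩Missing-empty-or-shellable j []      T       _ _ _ _ _ _ = inj₁ λ { _ ((_ , ()) , _) }
  Missing∩Missing-empty-or-shellable j (_ ∷ _) []      _ _ _ _ _ _ = inj₁ λ { _ (_ , (_ , ())) }
  Missing∩Missing-empty-or-shellable j (s ∷ S) (t ∷ T) ∣A∣≡ S⊆A T⊆A uS uT disjoint =
    inj₂ (Missing∩Missing-shellable j s S t T ∣A∣≡ S⊆A T⊆A uS uT disjoint)

  module CodimOneSubcomplex {j} (X : Complex v) (A : Subset v) (∣A∣≡ : ∣ A ∣ ≡ suc (suc j))
                  (X⊆A : ∀ σ → face X σ → σ ⊆ A)
                  (covered : ∀ σ → face X σ → InFaceOfSize (suc j) X σ)
                  (X? : ∀ σ → Dec (face X σ)) where

    Present Absent : Fin v → Set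
    Present a = a ∈ A × face X (A - a)
    Absent  a = a ∈ A × ¬ face X (A - a)

    present? : ∀ a → Dec (Present a)
    present? a = a ∈? A ×-dec X? (A - a)

    absent? : ∀ a → Dec (Absent a)
    absent? a = a ∈? A ×-dec ¬? (X? (A - a))

    present absent : List (Fin v)
    present = filter present? (allFin v)
    absent  = filter absent? (allFin v)

    ∈-present⁻ : ∀ {a} → a ∈ₗ present → Present a
    ∈-present⁻ = proj₂ ∘ ∈-filter⁻ present? {xs = allFin v}

    ∈-absent⁻ : ∀ {a} → a ∈ₗ absent → Absent a
    ∈-absent⁻ = proj₂ ∘ ∈-filter⁻ absent? {xs = allFin v}

    ∈-present⁺ : ∀ {a} → Present a → a ∈ₗ present
    ∈-present⁺ {a} = ∈-filter⁺ present? (∈-allFin a)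

    ∈-absent⁺ : ∀ {a} → Absent a → a ∈ₗ absent
    ∈-absent⁺ {a} = ∈-filter⁺ absent? (∈-allFin a)

    absent≢present : ∀ {a b} → Present a → Absent b → b ≢ a
    absent≢present (_ , A-a∈X) (_ , A-b∉X) refl = A-b∉X A-a∈X

    present-absent-disjoint : Disjoint present absent
    present-absent-disjoint (a∈present , a∈absent) =
      absent≢present (∈-present⁻ a∈present) (∈-absent⁻ a∈absent) refl

    face⇒misses-present : ∀ σ → face X σ → ∃ λ a → Present a × a ∉ σ
    face⇒misses-present σ σ∈X =
      let G , σ⊆G , G∈X , ∣G∣≡ = covered σ σ∈X
          G⊆A = X⊆A G G∈X
          a , a∈A , a∉G = p⊆q∧∣p∣<∣q∣⇒∃∈q∖p G⊆A (subst₂ _<_ (sym ∣G∣≡) (sym ∣A∣≡) (n<1+n _))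
          G≡A-a = p⊆q∧∣q∣≤∣p∣⇒p≡q (p⊆q∧x∉p⇒p⊆q-x G⊆A a∉G)
                    (≤-reflexive (trans (x∈p⇒∣p-x∣≡pred a∈A ∣A∣≡) (sym ∣G∣≡)))
      in a , (a∈A , subst (face X) G≡A-a G∈X) , a∉G ∘ σ⊆G

    present⇒facet : ∀ {a} → Present a → Facet X (A - a)
    present⇒facet {a} (a∈A , A-a∈X) = A-a∈X , maximal
      where
      maximal : ∀ G → face X G → A - a ⊆ G → G ≡ A - a
      maximal G G∈X A-a⊆G with face⇒misses-present G G∈X
      ... | c , (c∈A , _) , c∉G with c ≟ a
      ...   | yes refl = ⊆-antisym (p⊆q∧x∉p⇒p⊆q-x (X⊆A G G∈X) c∉G) A-a⊆G
      ...   | no  c≢a  = ⊥-elim (c∉G (A-a⊆G (x∈p∧x≢y⇒x∈p-y c∈A c≢a)))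

    facet⇒present : ∀ {F} → Facet X F → ∃ λ a → Present a × F ≡ A - a
    facet⇒present {F} (F∈X , maximal) =
      let a , (a∈A , A-a∈X) , a∉F = face⇒misses-present F F∈X
      in a , (a∈A , A-a∈X) , sym (maximal (A - a) A-a∈X (p⊆q∧x∉p⇒p⊆q-x (X⊆A F F∈X) a∉F))

    inOneFacet⇒absent : ∀ {ρ a b} → InExactlyOneFacet X ρ → Present a → ρ ⊆ A - a → b ∈ A - a → b ∉ ρ →
                        Absent b
    inOneFacet⇒absent {ρ} {a} {b} (_ , _ , _ , onlyF) Pa ρ⊆A-a b∈A-a b∉ρ = b∈A , A-b∉X
      where
      b∈A = p─q⊆p A ⁅ a ⁆ b∈A-a
      A-b∉X : ¬ face X (A - b)
      A-b∉X A-b∈X = x∉p-x (subst (b ∈_) A-a≡A-b b∈A-a)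
        where
        ρ⊆A-b = p⊆q∧x∉p⇒p⊆q-x (p⊆q-x⇒p⊆q ρ⊆A-a) b∉ρ
        A-a≡A-b = trans (onlyF (A - a) (present⇒facet Pa) ρ⊆A-a)
                        (sym (onlyF (A - b) (present⇒facet (b∈A , A-b∈X)) ρ⊆A-b))

    onlyFacet⊇A-a-b : ∀ {a b} → Present a → Absent b → ∀ G → Facet X G → A - a - b ⊆ G → G ≡ A - a
    onlyFacet⊇A-a-b {a} {b} _ (_ , A-b∉X) G G-facet A-a-b⊆G with facet⇒present G-facet
    ... | c , (c∈A , A-c∈X) , refl with c ≟ a | c ≟ b
    ...   | yes refl | _        = refl
    ...   | no _     | yes refl = ⊥-elim (A-b∉X A-c∈X)
    ...   | no c≢a   | no c≢b   = ⊥-elim (x∉p-x (A-a-b⊆G (x∈p∧x≢y∧x≢z⇒x∈p-y-z c∈A c≢a c≢b)))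

    ∂⇒Missing : ∀ {σ} → face (∂ (suc j) X) σ → face (Missing A present ∩ Missing A absent) σ
    ∂⇒Missing (ρ , σ⊆ρ , ρ∈X , ∣ρ∣≡j , ρ-inOneFacet) =
      let a , Pa , a∉ρ = face⇒misses-present ρ ρ∈X
          ρ⊆A-a = p⊆q∧x∉p⇒p⊆q-x (X⊆A ρ ρ∈X) a∉ρ
          ∣ρ∣<∣A-a∣ = subst₂ _<_ (sym ∣ρ∣≡j) (sym (x∈p⇒∣p-x∣≡pred (proj₁ Pa) ∣A∣≡)) (n<1+n j)
          b , b∈A-a , b∉ρ = p⊆q∧∣p∣<∣q∣⇒∃∈q∖p ρ⊆A-a ∣ρ∣<∣A-a∣
          σ⊆A = ⊆-trans σ⊆ρ (X⊆A ρ ρ∈X)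
      in (σ⊆A , lose (∈-present⁺ Pa) (a∉ρ ∘ σ⊆ρ)) ,
         (σ⊆A , lose (∈-absent⁺ (inOneFacet⇒absent ρ-inOneFacet Pa ρ⊆A-a b∈A-a b∉ρ)) (b∉ρ ∘ σ⊆ρ))

    Missing⇒∂ : ∀ {σ} → face (Missing A present ∩ Missing A absent) σ → face (∂ (suc j) X) σ
    Missing⇒∂ ((σ⊆A , missesPresent) , (_ , missesAbsent)) =
      let a , a∈present , a∉σ = find missesPresent
          b , b∈absent , b∉σ = find missesAbsent
          Pa@(a∈A , A-a∈X) = ∈-present⁻ a∈present
          Ab@(b∈A , _) = ∈-absent⁻ b∈absent
          b∈A-a = x∈p∧x≢y⇒x∈p-y b∈A (absent≢present Pa Ab)
          A-a-b⊆A-a = p─q⊆p (A - a) ⁅ b ⁆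
      in A - a - b , p⊆q∧x∉p⇒p⊆q-x (p⊆q∧x∉p⇒p⊆q-x σ⊆A a∉σ) b∉σ , down X A-a-b⊆A-a A-a∈X ,
         x∈p⇒∣p-x∣≡pred b∈A-a (x∈p⇒∣p-x∣≡pred a∈A ∣A∣≡) ,
         A - a , present⇒facet Pa , A-a-b⊆A-a , onlyFacet⊇A-a-b Pa Ab

    Missing≈∂ : (Missing A present ∩ Missing A absent) ≈ ∂ (suc j) X
    Missing≈∂ σ = mk⇔ (Missing⇒∂ {σ}) (∂⇒Missing {σ})

    ∂-empty-or-shellable : IsEmpty (∂ (suc j) X) ⊎ Shellable j (∂ (suc j) X)
    ∂-empty-or-shellable with Missing∩Missing-empty-or-shellable j present absent ∣A∣≡
                                (All.tabulate (proj₁ ∘ ∈-present⁻)) (All.tabulate (proj₁ ∘ ∈-absent⁻))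
                                (filter⁺ present? (allFin⁺ v)) (filter⁺ absent? (allFin⁺ v))
                                present-absent-disjoint
    ... | inj₁ empty     = inj₁ λ σ σ∈∂ → empty σ (∂⇒Missing σ∈∂)
    ... | inj₂ shellable = inj₂ (shellable-resp-≈ Missing≈∂ shellable)

  ∂-shellable-∩-simplex : ∀ {k} (U V : Complex v) → Shellable k (U ∩ V) → IsSimplex (suc k) V →
                          IsEmpty (∂ k (U ∩ V)) ⊎ ∃ λ j → k ≡ suc j × Shellable j (∂ k (U ∩ V))
  ∂-shellable-∩-simplex {zero}  U V _    _                     = inj₁ λ { _ (_ , _ , _ , () , _) }
  ∂-shellable-∩-simplex {suc j} U V sU∩V (A , ∣A∣≡ , V≈⟨A⟩) =
    Sum.map₂ (λ s∂ → j , refl , s∂)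
      (CodimOneSubcomplex.∂-empty-or-shellable (U ∩ V) A ∣A∣≡ (λ σ → to (V≈⟨A⟩ σ) ∘ proj₂)
        (shellable⇒covered sU∩V) (shellable-dec sU∩V))

proposition6 : (v k : ℕ) (Γ : Complex v) → Shellable k Γ → Sesquiconstructible k Γ
proposition6 v = <-rec (λ k → ∀ Γ → Shellable k Γ → Sesquiconstructible k Γ) step
  where
  step : ∀ k → (∀ {j} → j < k → ∀ Γ → Shellable j Γ → Sesquiconstructible j Γ) →
         ∀ Γ → Shellable k Γ → Sesquiconstructible k Γ
  step k       ih Γ (simplex pure s) = simplex pure s
  step (suc k) ih Γ (union {U = U} {V = V} pure sU sV sU∩V Γ≈U∪V) =
    union pure (step (suc k) ih _ sU) (simplex (isSimplex⇒pure {Γ = V} sV) sV) (ih (n<1+n k) _ sU∩V)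
      (Sum.map₂ (λ { (j , refl , s∂) → j , refl , ih (m<n⇒m<1+n (n<1+n j)) _ s∂ })
        (∂-shellable-∩-simplex U V sU∩V sV))
      Γ≈U∪V
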